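{- Let $R$ be a commutative ring, $n\ge1$, and let $A,B_1,\dots,B_n$ be square matrices over $R$ of the same size $k$. Let $M$ be the $nk\times nk$ block matrix \[M=\begin{pmatrix}1&0&0&\cdots&0&B_1\\ A&1&0&\cdots&0&B_2\\ 0&A&1&\cdots&0&B_3\\ \vdots&\vdots&\vdots&\ddots&\vdots&\vdots\\ 0&0&0&\cdots&1&B_{n-1}\\ 0&0&0&\cdots&A&1+B_n\end{pmatrix},\] where $1$ denotes the $k\times k$ identity matrix. Then \[\det(M)=\det\Big(1+\sum_{i=0}^{n-1}(-A)^iB_{n-i}\Big).\] -}

module Defs where

open import Level using (_⊔_)
open import Algebra.Bundles using (CommutativeRing)
open import Data.Nat as ℕ using (ℕ; zero; suc)
open import Data.Fin using (Fin; zero; suc; toℕ; punchIn; remQuot; opposite)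
open import Data.Product using (_,_)
open import Relation.Nullary using (yes; no)
open import Relation.Binary.PropositionalEquality using (_≡_)

module MatrixDefs {c ℓ} (R : CommutativeRing c ℓ) where
  open CommutativeRing R hiding (zero)

  Matrix : ℕ → ℕ → Set c
  Matrix m n = Fin m → Fin n → Carrier

  ∑ : ∀ {n} → (Fin n → Carrier) → Carrier
  ∑ {zero}  f = 0#
  ∑ {suc n} f = f zero + ∑ (λ i → f (suc i))

  sgn : ∀ {n} → Fin n → Carrier
  sgn zero    = 1#
  sgn (suc j) = - sgn j

  minor : ∀ {n} → Matrix (suc n) (suc n) → Fin (suc n) → Matrix n n
  minor M j r s = M (suc r) (punchIn j s)

  det : ∀ {n} → Matrix n n → Carrier
  det {zero}  M = 1#
  det {suc n} M = ∑ (λ j → sgn j * (M zero j * det (minor M j)))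

  δ : ℕ → ℕ → Carrier
  δ a b with a ℕ.≟ b
  ... | yes _ = 1#
  ... | no  _ = 0#

  𝟙 : ∀ {k} → Matrix k k
  𝟙 i j = δ (toℕ i) (toℕ j)

  𝟘 : ∀ {k} → Matrix k k
  𝟘 i j = 0#

  _⊕_ : ∀ {m n} → Matrix m n → Matrix m n → Matrix m n
  (X ⊕ Y) i j = X i j + Y i j

  ⊖_ : ∀ {m n} → Matrix m n → Matrix m n
  (⊖ X) i j = - X i j

  _⊗_ : ∀ {m n p} → Matrix m n → Matrix n p → Matrix m p
  (X ⊗ Y) i j = ∑ (λ l → X i l * Y l j)

  _^ᴹ_ : ∀ {k} → Matrix k k → ℕ → Matrix k k
  X ^ᴹ zero  = 𝟙
  X ^ᴹ suc e = X ⊗ (X ^ᴹ e)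

  ∑ᴹ : ∀ {n k} → (Fin n → Matrix k k) → Matrix k k
  ∑ᴹ {zero}  F = 𝟘
  ∑ᴹ {suc n} F = F zero ⊕ ∑ᴹ (λ i → F (suc i))

  _·ᴹ_ : ∀ {k} → Carrier → Matrix k k → Matrix k k
  (a ·ᴹ X) i j = a * X i j

  -- The (r,c) block (r, c ∈ {0,…,n-1}, 0-indexed) of the block matrix M:
  --   identity on the diagonal, A on the subdiagonal, B_{r+1} added in the
  --   last block column (so the bottom-right block is 1 + B_n).
  -- B zero = B_1, …, B (n-1) = B_n.
  block : ∀ n {k} → Matrix k k → (Fin n → Matrix k k) → Fin n → Fin n → Matrix k k
  block n A B r c =
    ((δ (toℕ r) (toℕ c) ·ᴹ 𝟙)
      ⊕ (δ (toℕ r) (suc (toℕ c)) ·ᴹ A))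
      ⊕ (δ (suc (toℕ c)) n ·ᴹ B r)

  -- the nk × nk block matrix, with index (r,i) ↦ r*k + i
  blockMatrix : ∀ n {k} → Matrix k k → (Fin n → Matrix k k) → Matrix (n ℕ.* k) (n ℕ.* k)
  blockMatrix n {k} A B p q with remQuot {n} k p | remQuot {n} k q
  ... | (r , i) | (c , j) = block n A B r c i j

-- For n ≥ 2 the leading k × k block of M is the identity, so det M is the determinant of the Schur
-- complement of that block. This complement is again a matrix of the same shape, with n - 1 block
-- rows and with B₁, B₂ replaced by the single block B₂ - A B₁, and by Horner's scheme this
-- replacement does not change ∑ (-A)ⁱ B_{n-i}. For n = 1 the matrix is 1 + B₁.
--
-- Since det is defined by cofactor expansion along the first row, the Schur complement formula is
-- proved by clearing the first column with row operations and expanding along it, which removes one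
-- row and column of the identity block at a time. Adding a multiple of the first row to another
-- row does not change det by multilinearity and because det vanishes when two rows agree. The
-- latter is proved for the first two rows by expanding along both and pairing the term deleting
-- columns (0, l + 1) with the one deleting (l + 1, 0), and reduced to that case for any other row
-- by swapping the first two rows.

module Submission where

open import Defs
open import Algebra.Bundles using (CommutativeRing)
open import Data.Nat as ℕ using (ℕ; zero; suc; _≤_; z≤n)
import Data.Nat.Properties as ℕₚ
open import Data.Fin using (Fin; zero; suc; toℕ; opposite; punchIn; _↑ˡ_; _↑ʳ_; combine; remQuot;
                            fromℕ; fromℕ<; inject₁; cast)
import Data.Fin.Properties as Finₚ
open import Data.Vec.Functional using (updateAt; _∷_)
open import Data.Vec.Functional.Properties using (updateAt-updates; updateAt-minimal)
open import Data.Product using (_×_; proj₁; proj₂)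
open import Relation.Binary.PropositionalEquality as ≡ using (_≡_; _≢_)
open import Relation.Nullary using (yes; no)
open import Relation.Nullary.Negation using (contradiction)
open import Function using (_∘_)

module _ {c ℓ} (R : CommutativeRing c ℓ) where

  open CommutativeRing R hiding (zero)
  open import Algebra.Properties.Ring ring
    using (-0#≈0#; -‿involutive; -‿distribˡ-*; -‿distribʳ-*; -‿+-comm; +-inverseˡ-unique)
  open import Algebra.Properties.CommutativeSemigroup *-commutativeSemigroup
    using () renaming (x∙yz≈y∙xz to x*[y*z]≈y*[x*z])
  open import Algebra.Properties.CommutativeSemigroup +-commutativeSemigroup
    using () renaming (interchange to +-interchange)
  open import Relation.Binary.Reasoning.Setoid setoid
  open MatrixDefs R

  y≈0⇒x+y≈x : ∀ {x y} → y ≈ 0# → x + y ≈ x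
  y≈0⇒x+y≈x {x} y≈0 = trans (+-congˡ y≈0) (+-identityʳ x)

  x≈0⇒x*y≈0 : ∀ {x y} → x ≈ 0# → x * y ≈ 0#
  x≈0⇒x*y≈0 {y = y} x≈0 = trans (*-cong x≈0 refl) (zeroˡ y)

  y≈0⇒x*y≈0 : ∀ {x y} → y ≈ 0# → x * y ≈ 0#
  y≈0⇒x*y≈0 {x} y≈0 = trans (*-cong refl y≈0) (zeroʳ x)

  y≈-x⇒x+y≈0 : ∀ {x y} → y ≈ - x → x + y ≈ 0#
  y≈-x⇒x+y≈0 {x} y≈-x = trans (+-congˡ y≈-x) (-‿inverseʳ x)

  x*[y*[a*z]]≈a*[x*[y*z]] : ∀ x y a z → x * (y * (a * z)) ≈ a * (x * (y * z))
  x*[y*[a*z]]≈a*[x*[y*z]] x y a z =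
    trans (*-cong refl (x*[y*z]≈y*[x*z] y a z)) (x*[y*z]≈y*[x*z] x a (y * z))

  [-a]*[[-b]*z]≈a*[b*z] : ∀ a b z → (- a) * ((- b) * z) ≈ a * (b * z)
  [-a]*[[-b]*z]≈a*[b*z] a b z = begin
    (- a) * ((- b) * z)   ≈⟨ *-cong refl (sym (-‿distribˡ-* b z)) ⟩
    (- a) * (- (b * z))   ≈⟨ sym (-‿distribʳ-* (- a) (b * z)) ⟩
    - ((- a) * (b * z))   ≈⟨ -‿cong (sym (-‿distribˡ-* a (b * z))) ⟩
    - (- (a * (b * z)))   ≈⟨ -‿involutive _ ⟩
    a * (b * z)           ∎

  [z+[-y]*x]-S≈z-[y*x+S] : ∀ z y x S → (z + (- y) * x) - S ≈ z - (y * x + S)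
  [z+[-y]*x]-S≈z-[y*x+S] z y x S = begin
    (z + (- y) * x) + - S    ≈⟨ +-assoc z _ _ ⟩
    z + ((- y) * x + - S)    ≈⟨ +-congˡ (+-congʳ (sym (-‿distribˡ-* y x))) ⟩
    z + (- (y * x) + - S)    ≈⟨ +-congˡ (-‿+-comm _ _) ⟩
    z + - (y * x + S)        ∎

  ∑-cong : ∀ {n} {f g : Fin n → Carrier} → (∀ i → f i ≈ g i) → ∑ f ≈ ∑ g
  ∑-cong {zero}  f≈g = refl
  ∑-cong {suc n} f≈g = +-cong (f≈g zero) (∑-cong (λ i → f≈g (suc i)))

  ∑-zero : ∀ {n} {f : Fin n → Carrier} → (∀ i → f i ≈ 0#) → ∑ f ≈ 0#
  ∑-zero {zero}  f≈0 = refl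
  ∑-zero {suc n} f≈0 = trans (y≈0⇒x+y≈x (∑-zero (λ i → f≈0 (suc i)))) (f≈0 zero)

  ∑-distrib-+ : ∀ {n} (f g : Fin n → Carrier) → ∑ (λ i → f i + g i) ≈ ∑ f + ∑ g
  ∑-distrib-+ {zero}  f g = sym (+-identityˡ 0#)
  ∑-distrib-+ {suc n} f g =
    trans (+-congˡ (∑-distrib-+ (λ i → f (suc i)) (λ i → g (suc i)))) (+-interchange _ _ _ _)

  *-distribˡ-∑ : ∀ {n} a (f : Fin n → Carrier) → a * ∑ f ≈ ∑ (λ i → a * f i)
  *-distribˡ-∑ {zero}  a f = zeroʳ a
  *-distribˡ-∑ {suc n} a f = trans (distribˡ a _ _) (+-congˡ (*-distribˡ-∑ a (λ i → f (suc i))))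

  *-distribʳ-∑ : ∀ {n} a (f : Fin n → Carrier) → ∑ f * a ≈ ∑ (λ i → f i * a)
  *-distribʳ-∑ {zero}  a f = zeroˡ a
  *-distribʳ-∑ {suc n} a f = trans (distribʳ a _ _) (+-congˡ (*-distribʳ-∑ a (λ i → f (suc i))))

  -‿distrib-∑ : ∀ {n} (f : Fin n → Carrier) → - ∑ f ≈ ∑ (λ i → - f i)
  -‿distrib-∑ {zero}  f = -0#≈0#
  -‿distrib-∑ {suc n} f = trans (sym (-‿+-comm _ _)) (+-congˡ (-‿distrib-∑ (λ i → f (suc i))))

  ∑-comm : ∀ {m n} (f : Fin m → Fin n → Carrier) →
           ∑ (λ i → ∑ (f i)) ≈ ∑ (λ j → ∑ (λ i → f i j))
  ∑-comm {zero}  {n} f = sym (∑-zero {n} (λ _ → refl))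
  ∑-comm {suc m} f = trans (+-congˡ (∑-comm (λ i → f (suc i)))) (sym (∑-distrib-+ (f zero) _))

  ∑-linear : ∀ {n} {f g h : Fin n → Carrier} a → (∀ i → f i ≈ g i + a * h i) →
             ∑ f ≈ ∑ g + a * ∑ h
  ∑-linear {f = f} {g} {h} a f≈g+ah = begin
    ∑ f                      ≈⟨ ∑-cong f≈g+ah ⟩
    ∑ (λ i → g i + a * h i)  ≈⟨ ∑-distrib-+ g _ ⟩
    ∑ g + ∑ (λ i → a * h i)  ≈⟨ +-congˡ (sym (*-distribˡ-∑ a h)) ⟩
    ∑ g + a * ∑ h            ∎

  a≡b⇒δ≡1 : ∀ {a b} → a ≡ b → δ a b ≡ 1#
  a≡b⇒δ≡1 {a} {b} a≡b with a ℕ.≟ b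
  ... | yes _  = ≡.refl
  ... | no a≢b = contradiction a≡b a≢b

  a≢b⇒δ≡0 : ∀ {a b} → a ≢ b → δ a b ≡ 0#
  a≢b⇒δ≡0 {a} {b} a≢b with a ℕ.≟ b
  ... | yes a≡b = contradiction a≡b a≢b
  ... | no _    = ≡.refl

  δ-suc : ∀ a b → δ (suc a) (suc b) ≡ δ a b
  δ-suc a b with a ℕ.≟ b
  ... | yes a≡b = a≡b⇒δ≡1 (≡.cong suc a≡b)
  ... | no a≢b  = a≢b⇒δ≡0 (λ sa≡sb → a≢b (ℕₚ.suc-injective sa≡sb))

  δ-refl : ∀ a → δ a a ≡ 1#
  δ-refl a = a≡b⇒δ≡1 {a} ≡.refl

  δ-0-suc : ∀ a → δ 0 (suc a) ≡ 0#
  δ-0-suc a = a≢b⇒δ≡0 {0} {suc a} (λ ())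

  δ-suc-0 : ∀ a → δ (suc a) 0 ≡ 0#
  δ-suc-0 a = a≢b⇒δ≡0 {suc a} {0} (λ ())

  ∑-𝟙 : ∀ {k} (i : Fin k) (f : Fin k → Carrier) → ∑ (λ l → 𝟙 i l * f l) ≈ f i
  ∑-𝟙 {suc k} zero f = begin
    δ 0 0 * f zero + ∑ (λ l → δ 0 (suc (toℕ l)) * f (suc l))
      ≈⟨ y≈0⇒x+y≈x (∑-zero (λ (l : Fin k) → x≈0⇒x*y≈0 (reflexive (δ-0-suc (toℕ l))))) ⟩
    δ 0 0 * f zero
      ≈⟨ trans (*-cong (reflexive (δ-refl 0)) refl) (*-identityˡ _) ⟩
    f zero ∎
  ∑-𝟙 {suc k} (suc i) f = begin
    δ (suc (toℕ i)) 0 * f zero + ∑ (λ l → δ (suc (toℕ i)) (suc (toℕ l)) * f (suc l))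
      ≈⟨ +-cong (x≈0⇒x*y≈0 (reflexive (δ-suc-0 (toℕ i))))
                (∑-cong (λ (l : Fin k) → *-cong (reflexive (δ-suc (toℕ i) (toℕ l))) refl)) ⟩
    0# + ∑ (λ l → 𝟙 i l * f (suc l))  ≈⟨ +-identityˡ _ ⟩
    ∑ (λ l → 𝟙 i l * f (suc l))       ≈⟨ ∑-𝟙 i (λ l → f (suc l)) ⟩
    f (suc i)                         ∎

  infix 4 _≈ᴹ_
  _≈ᴹ_ : ∀ {m n} → Matrix m n → Matrix m n → Set ℓ
  X ≈ᴹ Y = ∀ i j → X i j ≈ Y i j

  ≈ᴹ-refl : ∀ {m n} {X : Matrix m n} → X ≈ᴹ X
  ≈ᴹ-refl i j = refl

  ≈ᴹ-sym : ∀ {m n} {X Y : Matrix m n} → X ≈ᴹ Y → Y ≈ᴹ X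
  ≈ᴹ-sym X≈Y i j = sym (X≈Y i j)

  ≈ᴹ-trans : ∀ {m n} {X Y Z : Matrix m n} → X ≈ᴹ Y → Y ≈ᴹ Z → X ≈ᴹ Z
  ≈ᴹ-trans X≈Y Y≈Z i j = trans (X≈Y i j) (Y≈Z i j)

  ⊕-cong : ∀ {m n} {X X′ Y Y′ : Matrix m n} → X ≈ᴹ X′ → Y ≈ᴹ Y′ → X ⊕ Y ≈ᴹ X′ ⊕ Y′
  ⊕-cong X≈X′ Y≈Y′ i j = +-cong (X≈X′ i j) (Y≈Y′ i j)

  ⊗-cong : ∀ {m n p} {X X′ : Matrix m n} {Y Y′ : Matrix n p} →
           X ≈ᴹ X′ → Y ≈ᴹ Y′ → X ⊗ Y ≈ᴹ X′ ⊗ Y′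
  ⊗-cong {n = n} X≈X′ Y≈Y′ i j = ∑-cong (λ (l : Fin n) → *-cong (X≈X′ i l) (Y≈Y′ l j))

  ∑ᴹ-cong : ∀ {n k} {F G : Fin n → Matrix k k} → (∀ r → F r ≈ᴹ G r) → ∑ᴹ F ≈ᴹ ∑ᴹ G
  ∑ᴹ-cong {zero}  F≈G = ≈ᴹ-refl
  ∑ᴹ-cong {suc n} F≈G = ⊕-cong (F≈G zero) (∑ᴹ-cong (λ r → F≈G (suc r)))

  ⊕-identityʳ : ∀ {k} (X : Matrix k k) → X ⊕ 𝟘 ≈ᴹ X
  ⊕-identityʳ X i j = +-identityʳ (X i j)

  ⊗-identityˡ : ∀ {m n} (X : Matrix m n) → 𝟙 ⊗ X ≈ᴹ X
  ⊗-identityˡ X i j = ∑-𝟙 i (λ l → X l j)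

  ⊗-zeroʳ : ∀ {k} (X : Matrix k k) → X ⊗ 𝟘 ≈ᴹ 𝟘
  ⊗-zeroʳ {k} X i j = ∑-zero (λ (l : Fin k) → zeroʳ (X i l))

  ⊗-assoc : ∀ {m n p q} (X : Matrix m n) (Y : Matrix n p) (Z : Matrix p q) →
            (X ⊗ Y) ⊗ Z ≈ᴹ X ⊗ (Y ⊗ Z)
  ⊗-assoc {n = n} {p} X Y Z i j = begin
    ∑ (λ l → ∑ (λ t → X i t * Y t l) * Z l j)
      ≈⟨ ∑-cong (λ (l : Fin p) → *-distribʳ-∑ {n} (Z l j) _) ⟩
    ∑ (λ l → ∑ (λ t → (X i t * Y t l) * Z l j))
      ≈⟨ ∑-comm {p} {n} _ ⟩
    ∑ (λ t → ∑ (λ l → (X i t * Y t l) * Z l j))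
      ≈⟨ ∑-cong (λ (t : Fin n) → ∑-cong (λ (l : Fin p) → *-assoc _ _ _)) ⟩
    ∑ (λ t → ∑ (λ l → X i t * (Y t l * Z l j)))
      ≈⟨ ∑-cong (λ (t : Fin n) → sym (*-distribˡ-∑ {p} (X i t) _)) ⟩
    ∑ (λ t → X i t * ∑ (λ l → Y t l * Z l j)) ∎

  ⊗-distribˡ-⊕ : ∀ {m n p} (X : Matrix m n) (Y Z : Matrix n p) → X ⊗ (Y ⊕ Z) ≈ᴹ (X ⊗ Y) ⊕ (X ⊗ Z)
  ⊗-distribˡ-⊕ {n = n} X Y Z i j =
    trans (∑-cong (λ (l : Fin n) → distribˡ (X i l) _ _)) (∑-distrib-+ {n} _ _)

  ⊗-distribˡ-∑ᴹ : ∀ {n k} (X : Matrix k k) (F : Fin n → Matrix k k) →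
                  X ⊗ ∑ᴹ F ≈ᴹ ∑ᴹ (λ r → X ⊗ F r)
  ⊗-distribˡ-∑ᴹ {zero}  X F = ⊗-zeroʳ X
  ⊗-distribˡ-∑ᴹ {suc n} X F =
    ≈ᴹ-trans (⊗-distribˡ-⊕ X _ _) (⊕-cong ≈ᴹ-refl (⊗-distribˡ-∑ᴹ X (λ r → F (suc r))))

  -‿distribˡ-⊗ : ∀ {m n p} (X : Matrix m n) (Y : Matrix n p) → ⊖ (X ⊗ Y) ≈ᴹ (⊖ X) ⊗ Y
  -‿distribˡ-⊗ {n = n} X Y i j =
    trans (-‿distrib-∑ {n} _) (∑-cong (λ (l : Fin n) → -‿distribˡ-* (X i l) (Y l j)))

  det-cong : ∀ {n} {M N : Matrix n n} → M ≈ᴹ N → det M ≈ det N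
  det-cong {zero}  M≈N = refl
  det-cong {suc n} M≈N = ∑-cong (λ (j : Fin (suc n)) →
    *-cong (refl {sgn j}) (*-cong (M≈N zero j) (det-cong (λ r s → M≈N (suc r) (punchIn j s)))))

  det-linear : ∀ {n} (r : Fin n) (a : Carrier) {M N Q : Matrix n n} →
               (∀ i → i ≢ r → ∀ j → N i j ≈ M i j) → (∀ i → i ≢ r → ∀ j → Q i j ≈ M i j) →
               (∀ j → N r j ≈ M r j + a * Q r j) → det N ≈ det M + a * det Q
  det-linear {suc n} zero a {M} {N} {Q} N≈M Q≈M Nᵣ≈ = ∑-linear a (λ j → begin
    sgn j * (N zero j * det (minor N j))
      ≈⟨ *-cong refl (*-cong (Nᵣ≈ j) (det-cong (λ r s → N≈M (suc r) (λ ()) (punchIn j s)))) ⟩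
    sgn j * ((M zero j + a * Q zero j) * det (minor M j))
      ≈⟨ distribute (sgn j) (M zero j) (Q zero j) (det (minor M j)) ⟩
    sgn j * (M zero j * det (minor M j)) + a * (sgn j * (Q zero j * det (minor M j)))
      ≈⟨ +-congˡ (*-cong refl (*-cong refl (*-cong refl
           (det-cong (λ r s → sym (Q≈M (suc r) (λ ()) (punchIn j s))))))) ⟩
    sgn j * (M zero j * det (minor M j)) + a * (sgn j * (Q zero j * det (minor Q j))) ∎)
    where
    distribute : ∀ s m q d → s * ((m + a * q) * d) ≈ s * (m * d) + a * (s * (q * d))
    distribute s m q d = begin
      s * ((m + a * q) * d)            ≈⟨ *-cong refl (distribʳ d m (a * q)) ⟩
      s * (m * d + (a * q) * d)        ≈⟨ distribˡ s _ _ ⟩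
      s * (m * d) + s * ((a * q) * d)  ≈⟨ +-congˡ (*-cong refl (*-assoc a q d)) ⟩
      s * (m * d) + s * (a * (q * d))  ≈⟨ +-congˡ (x*[y*z]≈y*[x*z] s a (q * d)) ⟩
      s * (m * d) + a * (s * (q * d))  ∎
  det-linear {suc n} (suc r) a {M} {N} {Q} N≈M Q≈M Nᵣ≈ = ∑-linear a (λ j → begin
    sgn j * (N zero j * det (minor N j))
      ≈⟨ *-cong refl (*-cong (N≈M zero (λ ()) j) (det-linear r a
           (λ i i≢r s → N≈M (suc i) (i≢r ∘ Finₚ.suc-injective) (punchIn j s))
           (λ i i≢r s → Q≈M (suc i) (i≢r ∘ Finₚ.suc-injective) (punchIn j s))
           (λ s → Nᵣ≈ (punchIn j s)))) ⟩
    sgn j * (M zero j * (det (minor M j) + a * det (minor Q j)))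
      ≈⟨ distribute (sgn j) (M zero j) (det (minor M j)) (det (minor Q j)) ⟩
    sgn j * (M zero j * det (minor M j)) + a * (sgn j * (M zero j * det (minor Q j)))
      ≈⟨ +-congˡ (*-cong refl (*-cong refl (*-cong (sym (Q≈M zero (λ ()) j)) refl))) ⟩
    sgn j * (M zero j * det (minor M j)) + a * (sgn j * (Q zero j * det (minor Q j))) ∎)
    where
    distribute : ∀ s m x y → s * (m * (x + a * y)) ≈ s * (m * x) + a * (s * (m * y))
    distribute s m x y = begin
      s * (m * (x + a * y))            ≈⟨ *-cong refl (distribˡ m x (a * y)) ⟩
      s * (m * x + m * (a * y))        ≈⟨ distribˡ s _ _ ⟩
      s * (m * x) + s * (m * (a * y))  ≈⟨ +-congˡ (x*[y*[a*z]]≈a*[x*[y*z]] s m a y) ⟩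
      s * (m * x) + a * (s * (m * y))  ∎

  det-additive : ∀ {n} (r : Fin n) {M N Q : Matrix n n} →
                 (∀ i → i ≢ r → ∀ j → N i j ≈ M i j) → (∀ i → i ≢ r → ∀ j → Q i j ≈ M i j) →
                 (∀ j → N r j ≈ M r j + Q r j) → det N ≈ det M + det Q
  det-additive r N≈M Q≈M Nᵣ≈ =
    trans (det-linear r 1# N≈M Q≈M (λ j → trans (Nᵣ≈ j) (+-congˡ (sym (*-identityˡ _)))))
          (+-congˡ (*-identityˡ _))

  removeColumns : ∀ {p m} → Fin (suc (suc m)) → Fin (suc m) → Matrix p (suc (suc m)) → Matrix p m
  removeColumns j l X i t = X i (punchIn j (punchIn l t))

  -- The (j, l) term of the expansion of a determinant along two rows both equal to u, where
  -- g computes the determinant of the remaining rows X once columns j and punchIn j l are removed.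
  twoRowTerm : ∀ {p m} → (Matrix p m → Carrier) → (Fin (suc (suc m)) → Carrier) →
               Matrix p (suc (suc m)) → Fin (suc (suc m)) → Fin (suc m) → Carrier
  twoRowTerm g u X j l = sgn j * (sgn l * (u j * (u (punchIn j l) * g (removeColumns j l X))))

  ∑-twoRowTerm≈0 : ∀ {p m} (g : Matrix p m → Carrier) → (∀ {X Y} → X ≈ᴹ Y → g X ≈ g Y) →
                   ∀ u X → ∑ (λ j → ∑ (twoRowTerm g u X j)) ≈ 0#
  ∑-twoRowTerm≈0 {p} {m} g g-cong u X = begin
    ∑ (T zero) + ∑ (λ j → T (suc j) zero + ∑ (T↓ j))
      ≈⟨ +-congˡ (∑-distrib-+ (λ j → T (suc j) zero) (λ j → ∑ (T↓ j))) ⟩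
    ∑ (T zero) + (∑ (λ j → T (suc j) zero) + ∑ (λ j → ∑ (T↓ j)))
      ≈⟨ sym (+-assoc _ _ _) ⟩
    (∑ (T zero) + ∑ (λ j → T (suc j) zero)) + ∑ (λ j → ∑ (T↓ j))
      ≈⟨ +-cong (sym (∑-distrib-+ (T zero) (λ l → T (suc l) zero))) (shifted≈0 m g g-cong u X) ⟩
    ∑ (λ l → T zero l + T (suc l) zero) + 0#
      ≈⟨ y≈0⇒x+y≈x refl ⟩
    ∑ (λ l → T zero l + T (suc l) zero)
      ≈⟨ ∑-zero {f = λ l → T zero l + T (suc l) zero} paired≈0 ⟩
    0# ∎
    where
    T = twoRowTerm g u X
    T↓ : Fin (suc m) → Fin m → Carrier
    T↓ j l = T (suc j) (suc l)
    paired≈0 : ∀ l → T zero l + T (suc l) zero ≈ 0#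
    paired≈0 l = y≈-x⇒x+y≈0 (begin
      (- sgn l) * (1# * (u (suc l) * (u zero * G)))  ≈⟨ sym (-‿distribˡ-* _ _) ⟩
      - (sgn l * (1# * (u (suc l) * (u zero * G))))  ≈⟨ -‿cong (*-cong refl (*-identityˡ _)) ⟩
      - (sgn l * (u (suc l) * (u zero * G)))         ≈⟨ -‿cong (*-cong refl (x*[y*z]≈y*[x*z] _ _ _)) ⟩
      - (sgn l * (u zero * (u (suc l) * G)))         ≈⟨ -‿cong (sym (*-identityˡ _)) ⟩
      - T zero l                                     ∎)
      where G = g (removeColumns zero l X)
    -- when neither deleted column is column 0, that column becomes part of the remaining rows
    shifted≈0 : ∀ m (g : Matrix p m → Carrier) → (∀ {X Y} → X ≈ᴹ Y → g X ≈ g Y) →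
                ∀ u X → ∑ (λ j → ∑ (λ l → twoRowTerm g u X (suc j) (suc l))) ≈ 0#
    shifted≈0 zero    g g-cong u X = ∑-zero {1} (λ _ → refl)
    shifted≈0 (suc m) g g-cong u X = trans
      (∑-cong {f = λ j → ∑ (λ l → twoRowTerm g u X (suc j) (suc l))} {g = λ j → ∑ (T′ j)} (λ j →
        ∑-cong {f = λ l → twoRowTerm g u X (suc j) (suc l)} {g = T′ j} (λ l → begin
          (- sgn j) * ((- sgn l) * (u (suc j) * (u (suc (punchIn j l)) * G j l)))
            ≈⟨ [-a]*[[-b]*z]≈a*[b*z] _ _ _ ⟩
          sgn j * (sgn l * (u (suc j) * (u (suc (punchIn j l)) * G j l)))
            ≈⟨ *-cong refl (*-cong refl (*-cong refl (*-cong refl (g-cong column₀-split)))) ⟩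
          T′ j l ∎)))
      (∑-twoRowTerm≈0 g′ (λ Y≈Y′ → g-cong (λ { i zero → refl ; i (suc t) → Y≈Y′ i t })) u′ X′)
      where
      u′ = λ t → u (suc t)
      X′ : Matrix p (suc (suc m))
      X′ i t = X i (suc t)
      g′ : Matrix p m → Carrier
      g′ Y = g (λ i → X i zero ∷ Y i)
      T′ = twoRowTerm g′ u′ X′
      G : Fin (suc (suc m)) → Fin (suc m) → Carrier
      G j l = g (removeColumns (suc j) (suc l) X)
      column₀-split : ∀ {j l} → removeColumns (suc j) (suc l) X ≈ᴹ (λ i → X i zero ∷ removeColumns j l X′ i)
      column₀-split i zero    = refl
      column₀-split i (suc t) = refl

  row₀≈row₁⇒det≈0 : ∀ {m} (M : Matrix (suc (suc m)) (suc (suc m))) →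
                    (∀ j → M zero j ≈ M (suc zero) j) → det M ≈ 0#
  row₀≈row₁⇒det≈0 {m} M row₀≈row₁ =
    trans (∑-cong {f = λ j → sgn j * (u j * det (minor M j))} expand) (∑-twoRowTerm≈0 det det-cong u X)
    where
    u = M zero
    X = λ i → M (suc (suc i))
    F : Fin (suc (suc m)) → Fin (suc m) → Carrier
    F j l = sgn l * (M (suc zero) (punchIn j l) * det (minor (minor M j) l))
    expand : ∀ j → sgn j * (u j * ∑ (F j)) ≈ ∑ (twoRowTerm det u X j)
    expand j = begin
      sgn j * (u j * ∑ (F j))          ≈⟨ *-cong refl (*-distribˡ-∑ (u j) (F j)) ⟩
      sgn j * ∑ (λ l → u j * F j l)    ≈⟨ *-distribˡ-∑ (sgn j) (λ l → u j * F j l) ⟩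
      ∑ (λ l → sgn j * (u j * F j l))
        ≈⟨ ∑-cong {f = λ l → sgn j * (u j * F j l)} {g = twoRowTerm det u X j} (λ l →
             *-cong refl (trans (x*[y*z]≈y*[x*z] _ _ _)
               (*-cong refl (*-cong refl (*-cong (sym (row₀≈row₁ (punchIn j l))) refl))))) ⟩
      ∑ (twoRowTerm det u X j)         ∎

  det-swap₀₁ : ∀ {m} (x y : Fin (suc (suc m)) → Carrier) (X : Matrix m (suc (suc m))) →
               det (x ∷ y ∷ X) + det (y ∷ x ∷ X) ≈ 0#
  det-swap₀₁ {m} x y X = begin
    det (x ∷ y ∷ X) + det (y ∷ x ∷ X)
      ≈⟨ sym (+-cong (trans (+-congʳ (row₀≈row₁⇒det≈0 (x ∷ x ∷ X) (λ _ → refl))) (+-identityˡ _))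
                     (y≈0⇒x+y≈x (row₀≈row₁⇒det≈0 (y ∷ y ∷ X) (λ _ → refl)))) ⟩
    (det (x ∷ x ∷ X) + det (x ∷ y ∷ X)) + (det (y ∷ x ∷ X) + det (y ∷ y ∷ X))
      ≈⟨ sym (+-cong (additive₁ x) (additive₁ y)) ⟩
    det (x ∷ w ∷ X) + det (y ∷ w ∷ X)
      ≈⟨ sym (det-additive zero {M = x ∷ w ∷ X} {N = w ∷ w ∷ X} {Q = y ∷ w ∷ X} row₀-only row₀-only
                                (λ _ → refl)) ⟩
    det (w ∷ w ∷ X)
      ≈⟨ row₀≈row₁⇒det≈0 (w ∷ w ∷ X) (λ _ → refl) ⟩
    0# ∎
    where
    w = λ j → x j + y j
    row₀-only : ∀ {a b z : Fin (suc (suc m)) → Carrier} i → i ≢ zero → ∀ j →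
                (a ∷ z ∷ X) i j ≈ (b ∷ z ∷ X) i j
    row₀-only zero    0≢0 = contradiction ≡.refl 0≢0
    row₀-only (suc i) _ j = refl
    row₁-only : ∀ {a b z : Fin (suc (suc m)) → Carrier} i → i ≢ suc zero → ∀ j →
                (z ∷ a ∷ X) i j ≈ (z ∷ b ∷ X) i j
    row₁-only zero          _   j = refl
    row₁-only (suc zero)    1≢1 = contradiction ≡.refl 1≢1
    row₁-only (suc (suc i)) _   j = refl
    additive₁ : ∀ z → det (z ∷ w ∷ X) ≈ det (z ∷ x ∷ X) + det (z ∷ y ∷ X)
    additive₁ z = det-additive (suc zero) {M = z ∷ x ∷ X} {N = z ∷ w ∷ X} {Q = z ∷ y ∷ X}
                               row₁-only row₁-only (λ _ → refl)

  row₀≈row⇒det≈0 : ∀ {n} (M : Matrix (suc n) (suc n)) (r : Fin n) →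
                   (∀ j → M zero j ≈ M (suc r) j) → det M ≈ 0#
  row₀≈row⇒det≈0 M zero row₀≈rowᵣ = row₀≈row₁⇒det≈0 M row₀≈rowᵣ
  row₀≈row⇒det≈0 {suc n} M (suc r) row₀≈rowᵣ = begin
    det M      ≈⟨ det-cong {M = M} {N = M zero ∷ M (suc zero) ∷ X} rows ⟩
    det (M zero ∷ M (suc zero) ∷ X)
               ≈⟨ +-inverseˡ-unique _ _ (det-swap₀₁ (M zero) (M (suc zero)) X) ⟩
    - det M↔   ≈⟨ -‿cong (∑-zero {f = λ j → sgn j * (M↔ zero j * det (minor M↔ j))} (λ j →
                    y≈0⇒x*y≈0 (y≈0⇒x*y≈0
                      (row₀≈row⇒det≈0 (minor M↔ j) r (λ s → row₀≈rowᵣ (punchIn j s)))))) ⟩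
    - 0#       ≈⟨ -0#≈0# ⟩
    0#         ∎
    where
    X = λ i → M (suc (suc i))
    M↔ = M (suc zero) ∷ M zero ∷ X
    rows : M ≈ᴹ M zero ∷ M (suc zero) ∷ X
    rows zero          j = refl
    rows (suc zero)    j = refl
    rows (suc (suc i)) j = refl

  det-addRow₀Multiple : ∀ {n} (r : Fin n) (a : Carrier) {M N : Matrix (suc n) (suc n)} →
                        (∀ i → i ≢ suc r → ∀ j → N i j ≈ M i j) →
                        (∀ j → N (suc r) j ≈ M (suc r) j + a * M zero j) → det N ≈ det M
  det-addRow₀Multiple r a {M} {N} N≈M Nᵣ≈ = begin
    det N
      ≈⟨ det-linear (suc r) a N≈M Q≈M (λ j → trans (Nᵣ≈ j) (+-congˡ (*-cong refl (sym (Qᵣ≈M₀ j))))) ⟩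
    det M + a * det Q
      ≈⟨ y≈0⇒x+y≈x (y≈0⇒x*y≈0
           (row₀≈row⇒det≈0 Q r (λ j → trans (Q≈M zero (λ ()) j) (sym (Qᵣ≈M₀ j))))) ⟩
    det M ∎
    where
    Q = updateAt M (suc r) (λ _ → M zero)
    Q≈M : ∀ i → i ≢ suc r → ∀ j → Q i j ≈ M i j
    Q≈M i i≢r j = reflexive (≡.cong (λ row → row j) (updateAt-minimal i (suc r) M i≢r))
    Qᵣ≈M₀ : ∀ j → Q (suc r) j ≈ M zero j
    Qᵣ≈M₀ j = reflexive (≡.cong (λ row → row j) (updateAt-updates (suc r) M))

  addRow₀Multiples : ∀ {n} → (Fin n → Carrier) → Matrix (suc n) (suc n) → Matrix (suc n) (suc n)
  addRow₀Multiples c M = M zero ∷ λ i j → M (suc i) j + c i * M zero j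

  det-addRow₀Multiples : ∀ {n} (c : Fin n → Carrier) (M : Matrix (suc n) (suc n)) →
                         det (addRow₀Multiples c M) ≈ det M
  det-addRow₀Multiples {n} c M =
    supportBelow n c (λ i n≤i → contradiction (Finₚ.toℕ<n i) (ℕₚ.≤⇒≯ n≤i))
    where
    -- induction on a bound t for the rows that are actually modified
    supportBelow : ∀ t (c : Fin n → Carrier) → (∀ i → t ≤ toℕ i → c i ≈ 0#) →
                   det (addRow₀Multiples c M) ≈ det M
    supportBelow zero c c≈0 = det-cong {M = addRow₀Multiples c M} {N = M} λ where
      zero    j → refl
      (suc i) j → y≈0⇒x+y≈x (x≈0⇒x*y≈0 (c≈0 i z≤n))
    supportBelow (suc t) c c≈0 with t ℕ.<? n
    ... | no t≮n  = supportBelow t c (λ i t≤i → contradiction (ℕₚ.≤-<-trans t≤i (Finₚ.toℕ<n i)) t≮n)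
    ... | yes t<n = trans (det-addRow₀Multiple r (c r) agree rowᵣ) (supportBelow t c′ c′≈0)
      where
      r = fromℕ< t<n
      c′ = updateAt c r (λ _ → 0#)
      c′ᵣ≈0 : c′ r ≈ 0#
      c′ᵣ≈0 = reflexive (updateAt-updates r c)
      c′≈c : ∀ i → i ≢ r → c′ i ≈ c i
      c′≈c i i≢r = reflexive (updateAt-minimal i r c i≢r)
      t≡i⇒i≡r : ∀ {i} → t ≡ toℕ i → i ≡ r
      t≡i⇒i≡r t≡i = Finₚ.toℕ-injective (≡.trans (≡.sym t≡i) (≡.sym (Finₚ.toℕ-fromℕ< t<n)))
      c′≈0 : ∀ i → t ≤ toℕ i → c′ i ≈ 0#
      c′≈0 i t≤i with i Finₚ.≟ r
      ... | yes ≡.refl = c′ᵣ≈0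
      ... | no i≢r     = trans (c′≈c i i≢r) (c≈0 i (ℕₚ.≤∧≢⇒< t≤i (i≢r ∘ t≡i⇒i≡r)))
      agree : ∀ i → i ≢ suc r → ∀ j → addRow₀Multiples c M i j ≈ addRow₀Multiples c′ M i j
      agree zero    _     j = refl
      agree (suc i) si≢sr j = +-congˡ (*-cong (sym (c′≈c i (si≢sr ∘ ≡.cong suc))) refl)
      rowᵣ : ∀ j → addRow₀Multiples c M (suc r) j ≈ addRow₀Multiples c′ M (suc r) j + c r * M zero j
      rowᵣ j = +-congʳ (sym (y≈0⇒x+y≈x (x≈0⇒x*y≈0 c′ᵣ≈0)))

  column₀≈0⇒det≈0 : ∀ {n} (M : Matrix (suc n) (suc n)) → (∀ i → M i zero ≈ 0#) → det M ≈ 0#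
  column₀≈0⇒det≈0 {zero}  M col≈0 = trans (+-identityʳ _) (y≈0⇒x*y≈0 (x≈0⇒x*y≈0 (col≈0 zero)))
  column₀≈0⇒det≈0 {suc n} M col≈0 = ∑-zero {f = λ j → sgn j * (M zero j * det (minor M j))} λ where
    zero    → y≈0⇒x*y≈0 (x≈0⇒x*y≈0 (col≈0 zero))
    (suc j) → y≈0⇒x*y≈0 (y≈0⇒x*y≈0 (column₀≈0⇒det≈0 (minor M (suc j)) (λ i → col≈0 (suc i))))

  det-expand-column₀ : ∀ {n} (M : Matrix (suc n) (suc n)) → (∀ i → M (suc i) zero ≈ 0#) →
                       det M ≈ M zero zero * det (minor M zero)
  det-expand-column₀ {zero}  M col≈0 = trans (+-identityʳ _) (*-identityˡ _)
  det-expand-column₀ {suc n} M col≈0 = trans (y≈0⇒x+y≈x (∑-zero {f = tail} tail≈0)) (*-identityˡ _)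
    where
    tail = λ j → sgn (suc j) * (M zero (suc j) * det (minor M (suc j)))
    tail≈0 : ∀ j → tail j ≈ 0#
    tail≈0 j = y≈0⇒x*y≈0 (y≈0⇒x*y≈0 (column₀≈0⇒det≈0 (minor M (suc j)) col≈0))

  -- D - C E, the Schur complement of the leading k × k block when M = [[1, E], [C, D]]
  schurComplement : ∀ k {s} → Matrix (k ℕ.+ s) (k ℕ.+ s) → Matrix s s
  schurComplement k {s} M t t′ =
    M (k ↑ʳ t) (k ↑ʳ t′) - ∑ (λ b → M (k ↑ʳ t) (b ↑ˡ s) * M (b ↑ˡ s) (k ↑ʳ t′))

  det-schur : ∀ k {s} (M : Matrix (k ℕ.+ s) (k ℕ.+ s)) → (∀ a b → M (a ↑ˡ s) (b ↑ˡ s) ≈ 𝟙 a b) →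
              det M ≈ det (schurComplement k M)
  det-schur zero    M _ = det-cong {M = M} {N = schurComplement zero M} (λ t t′ → sym (y≈0⇒x+y≈x -0#≈0#))
  det-schur (suc k) {s} M upperLeft≈𝟙 = begin
    det M                                   ≈⟨ sym (det-addRow₀Multiples _ M) ⟩
    det M′                                  ≈⟨ det-expand-column₀ M′ column₀≈0 ⟩
    M zero zero * det (minor M′ zero)       ≈⟨ trans (*-cong M₀₀≈1 refl) (*-identityˡ _) ⟩
    det (minor M′ zero)                     ≈⟨ det-schur k (minor M′ zero) minor-upperLeft≈𝟙 ⟩
    det (schurComplement k (minor M′ zero)) ≈⟨ det-cong {M = schurComplement k (minor M′ zero)}
                                                         {N = schurComplement (suc k) M} schur-minor ⟩
    det (schurComplement (suc k) M)         ∎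
    where
    M′ = addRow₀Multiples (λ i → - M (suc i) zero) M
    M₀₀≈1 : M zero zero ≈ 1#
    M₀₀≈1 = trans (upperLeft≈𝟙 zero zero) (reflexive (δ-refl 0))
    M₀ₛ≈0 : ∀ b → M zero (suc b ↑ˡ s) ≈ 0#
    M₀ₛ≈0 b = trans (upperLeft≈𝟙 zero (suc b)) (reflexive (δ-0-suc (toℕ b)))
    Mₛ₀≈0 : ∀ b → M (suc b ↑ˡ s) zero ≈ 0#
    Mₛ₀≈0 b = trans (upperLeft≈𝟙 (suc b) zero) (reflexive (δ-suc-0 (toℕ b)))
    column₀≈0 : ∀ i → M′ (suc i) zero ≈ 0#
    column₀≈0 i = y≈-x⇒x+y≈0 (trans (*-cong refl M₀₀≈1) (*-identityʳ _))
    minor-upperLeft≈𝟙 : ∀ a b → minor M′ zero (a ↑ˡ s) (b ↑ˡ s) ≈ 𝟙 a b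
    minor-upperLeft≈𝟙 a b = begin
      M (suc a ↑ˡ s) (suc b ↑ˡ s) + (- M (suc a ↑ˡ s) zero) * M zero (suc b ↑ˡ s)
        ≈⟨ y≈0⇒x+y≈x (y≈0⇒x*y≈0 (M₀ₛ≈0 b)) ⟩
      M (suc a ↑ˡ s) (suc b ↑ˡ s)  ≈⟨ upperLeft≈𝟙 (suc a) (suc b) ⟩
      𝟙 (suc a) (suc b)            ≈⟨ reflexive (δ-suc (toℕ a) (toℕ b)) ⟩
      𝟙 a b                        ∎
    schur-minor : schurComplement k (minor M′ zero) ≈ᴹ schurComplement (suc k) M
    schur-minor t t′ = begin
      (z + (- y) * x) - ∑ (λ b → (Y b + (- y) * M zero (suc b ↑ˡ s)) * (X b + (- M (suc b ↑ˡ s) zero) * x))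
        ≈⟨ +-congˡ (-‿cong (∑-cong (λ b →
             *-cong (y≈0⇒x+y≈x (y≈0⇒x*y≈0 (M₀ₛ≈0 b)))
                    (y≈0⇒x+y≈x (x≈0⇒x*y≈0 (trans (-‿cong (Mₛ₀≈0 b)) -0#≈0#)))))) ⟩
      (z + (- y) * x) - ∑ (λ b → Y b * X b)
        ≈⟨ [z+[-y]*x]-S≈z-[y*x+S] z y x _ ⟩
      z - (y * x + ∑ (λ b → Y b * X b)) ∎
      where
      z = M (suc k ↑ʳ t) (suc k ↑ʳ t′)
      y = M (suc k ↑ʳ t) zero
      x = M zero (suc k ↑ʳ t′)
      Y : Fin k → Carrier
      Y b = M (suc k ↑ʳ t) (suc b ↑ˡ s)
      X : Fin k → Carrier
      X b = M (suc b ↑ˡ s) (suc k ↑ʳ t′)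

  det-cast : ∀ {m n} (e : m ≡ n) (M : Matrix n n) → det (λ i j → M (cast e i) (cast e j)) ≈ det M
  det-cast ≡.refl M =
    det-cong (λ i j → reflexive (≡.cong₂ M (Finₚ.cast-is-id ≡.refl i) (Finₚ.cast-is-id ≡.refl j)))

  module _ {k} (A : Matrix k k) where

    powerSum : ∀ {n} → (Fin n → Matrix k k) → Matrix k k
    powerSum B = ∑ᴹ (λ i → ((⊖ A) ^ᴹ toℕ i) ⊗ B (opposite i))

    powerSum-horner : ∀ {n} (B : Fin (suc n) → Matrix k k) →
                      powerSum B ≈ᴹ B (fromℕ n) ⊕ ((⊖ A) ⊗ powerSum (B ∘ inject₁))
    powerSum-horner B = ⊕-cong (⊗-identityˡ _) (≈ᴹ-trans
      (∑ᴹ-cong (λ i → ⊗-assoc (⊖ A) ((⊖ A) ^ᴹ toℕ i) (B (inject₁ (opposite i)))))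
      (≈ᴹ-sym (⊗-distribˡ-∑ᴹ (⊖ A) (λ i → ((⊖ A) ^ᴹ toℕ i) ⊗ B (inject₁ (opposite i))))))

    powerSum-one : (B : Fin 1 → Matrix k k) → powerSum B ≈ᴹ B zero
    powerSum-one B = ≈ᴹ-trans (⊕-identityʳ _) (⊗-identityˡ (B zero))

    -- Taking the Schur complement of the leading identity block merges B₁ and B₂ into B₂ - A B₁.
    mergeFirst : ∀ {m} → (Fin (suc (suc m)) → Matrix k k) → Fin (suc m) → Matrix k k
    mergeFirst B zero    = B (suc zero) ⊕ ((⊖ A) ⊗ B zero)
    mergeFirst B (suc r) = B (suc (suc r))

    powerSum-mergeFirst : ∀ {m} (B : Fin (suc (suc m)) → Matrix k k) →
                          powerSum (mergeFirst B) ≈ᴹ powerSum B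
    powerSum-mergeFirst {zero} B = ≈ᴹ-trans (powerSum-one (mergeFirst B)) (≈ᴹ-sym
      (≈ᴹ-trans (powerSum-horner B) (⊕-cong ≈ᴹ-refl (⊗-cong ≈ᴹ-refl (powerSum-one (B ∘ inject₁))))))
    powerSum-mergeFirst {suc m} B =
      ≈ᴹ-trans (powerSum-horner (mergeFirst B)) (≈ᴹ-trans
        (⊕-cong ≈ᴹ-refl (⊗-cong ≈ᴹ-refl (≈ᴹ-trans
          (∑ᴹ-cong (λ i → ⊗-cong (≈ᴹ-refl {X = (⊖ A) ^ᴹ toℕ i}) (inject₁-mergeFirst (opposite i))))
          (powerSum-mergeFirst (B ∘ inject₁)))))
        (≈ᴹ-sym (powerSum-horner B)))
      where
      inject₁-mergeFirst : ∀ r → mergeFirst B (inject₁ r) ≈ᴹ mergeFirst (B ∘ inject₁) r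
      inject₁-mergeFirst zero    = ≈ᴹ-refl
      inject₁-mergeFirst (suc r) = ≈ᴹ-refl

    blockMatrix-combine : ∀ n (B : Fin n → Matrix k k) r c i j →
                          blockMatrix n A B (combine r i) (combine c j) ≡ block n A B r c i j
    blockMatrix-combine n B r c i j =
      ≡.cong₂ (λ (ri cj : Fin n × Fin k) → block n A B (proj₁ ri) (proj₁ cj) (proj₂ ri) (proj₂ cj))
              (Finₚ.remQuot-combine r i) (Finₚ.remQuot-combine c j)

    ≈ᴹ-byBlocks : ∀ {n} {X Y : Matrix (n ℕ.* k) (n ℕ.* k)} →
                  (∀ r c i j → X (combine r i) (combine c j) ≈ Y (combine r i) (combine c j)) → X ≈ᴹ Y
    ≈ᴹ-byBlocks {n} {X} {Y} X≈Y p q =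
      ≡.subst₂ (λ p q → X p q ≈ Y p q) (Finₚ.combine-remQuot {n} k p) (Finₚ.combine-remQuot {n} k q)
               (X≈Y (quotient p) (quotient q) (remainder p) (remainder q))
      where
      quotient = λ p → proj₁ (remQuot {n} k p)
      remainder = λ p → proj₂ (remQuot {n} k p)

    block-entry : ∀ n (B : Fin n → Matrix k k) r c {a b d} →
                  δ (toℕ r) (toℕ c) ≡ a → δ (toℕ r) (suc (toℕ c)) ≡ b → δ (suc (toℕ c)) n ≡ d →
                  ∀ i j → block n A B r c i j ≈ (a * 𝟙 i j + b * A i j) + d * B r i j
    block-entry n B r c ≡a ≡b ≡d i j = reflexive
      (≡.cong₂ _+_ (≡.cong₂ _+_ (≡.cong (_* 𝟙 i j) ≡a) (≡.cong (_* A i j) ≡b))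
                   (≡.cong (_* B r i j) ≡d))

    module _ {m} (B : Fin (suc (suc m)) → Matrix k k) where

      private
        blocks : Fin (suc (suc m)) → Fin (suc (suc m)) → Matrix k k
        blocks = block (suc (suc m)) A B

        δ-1-2+m : δ 1 (suc (suc m)) ≡ 0#
        δ-1-2+m = ≡.trans (δ-suc 0 (suc m)) (δ-0-suc m)

      block-zero-zero : blocks zero zero ≈ᴹ 𝟙
      block-zero-zero i j = trans (block-entry _ B zero zero (δ-refl 0) (δ-0-suc 0) δ-1-2+m i j)
        (trans (y≈0⇒x+y≈x (zeroˡ _)) (trans (y≈0⇒x+y≈x (zeroˡ _)) (*-identityˡ _)))

      block-zero-suc : ∀ c → blocks zero (suc c) ≈ᴹ δ (suc (toℕ c)) (suc m) ·ᴹ B zero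
      block-zero-suc c i j = trans
        (block-entry _ B zero (suc c) (δ-0-suc (toℕ c)) (δ-0-suc (suc (toℕ c)))
                     (δ-suc (suc (toℕ c)) (suc m)) i j)
        (trans (+-congʳ (trans (y≈0⇒x+y≈x (zeroˡ _)) (zeroˡ _))) (+-identityˡ _))

      block-one-zero : blocks (suc zero) zero ≈ᴹ A
      block-one-zero i j = trans (block-entry _ B (suc zero) zero (δ-suc-0 0) (δ-refl 1) δ-1-2+m i j)
        (trans (y≈0⇒x+y≈x (zeroˡ _)) (trans (+-congʳ (zeroˡ _)) (trans (+-identityˡ _) (*-identityˡ _))))

      block-suc-suc-zero : ∀ r → blocks (suc (suc r)) zero ≈ᴹ 𝟘
      block-suc-suc-zero r i j = trans
        (block-entry _ B (suc (suc r)) zero (δ-suc-0 (suc (toℕ r)))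
                     (≡.trans (δ-suc (suc (toℕ r)) 0) (δ-suc-0 (toℕ r))) δ-1-2+m i j)
        (trans (y≈0⇒x+y≈x (zeroˡ _)) (trans (y≈0⇒x+y≈x (zeroˡ _)) (zeroˡ _)))

      block-suc-suc : ∀ r c → blocks (suc r) (suc c) ≈ᴹ block (suc m) A (B ∘ suc) r c
      block-suc-suc r c =
        block-entry _ B (suc r) (suc c) (δ-suc (toℕ r) (toℕ c)) (δ-suc (toℕ r) (suc (toℕ c)))
                    (δ-suc (suc (toℕ c)) (suc m))

      block-schur : ∀ r c i j →
                    blocks (suc r) (suc c) i j - ∑ (λ b → blocks (suc r) zero i b * blocks zero (suc c) b j)
                    ≈ block (suc m) A (mergeFirst B) r c i j
      block-schur zero c i j = begin
        blocks (suc zero) (suc c) i j - ∑ (λ b → blocks (suc zero) zero i b * blocks zero (suc c) b j)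
          ≈⟨ +-cong (block-suc-suc zero c i j)
                    (-‿cong (∑-cong (λ b → *-cong (block-one-zero i b) (block-zero-suc c b j)))) ⟩
        (U + d * B (suc zero) i j) - ∑ (λ b → A i b * (d * B zero b j))
          ≈⟨ +-congˡ (-‿cong (trans (∑-cong (λ (b : Fin k) → x*[y*z]≈y*[x*z] (A i b) d _))
                                   (sym (*-distribˡ-∑ d (λ b → A i b * B zero b j))))) ⟩
        (U + d * B (suc zero) i j) - d * (A ⊗ B zero) i j
          ≈⟨ +-assoc _ _ _ ⟩
        U + (d * B (suc zero) i j - d * (A ⊗ B zero) i j)
          ≈⟨ +-congˡ (+-congˡ (trans (-‿distribʳ-* d _) (*-cong refl (-‿distribˡ-⊗ A (B zero) i j)))) ⟩
        U + (d * B (suc zero) i j + d * ((⊖ A) ⊗ B zero) i j)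
          ≈⟨ +-congˡ (sym (distribˡ d _ _)) ⟩
        U + d * mergeFirst B zero i j ∎
        where
        U = δ 0 (toℕ c) * 𝟙 i j + δ 0 (suc (toℕ c)) * A i j
        d = δ (suc (toℕ c)) (suc m)
      block-schur (suc r) c i j = begin
        blocks (suc (suc r)) (suc c) i j - ∑ (λ b → blocks (suc (suc r)) zero i b * blocks zero (suc c) b j)
          ≈⟨ y≈0⇒x+y≈x (trans (-‿cong (∑-zero (λ b → x≈0⇒x*y≈0 (block-suc-suc-zero r i b))))
                             -0#≈0#) ⟩
        blocks (suc (suc r)) (suc c) i j
          ≈⟨ block-suc-suc (suc r) c i j ⟩
        block (suc m) A (mergeFirst B) (suc r) c i j ∎

      blockMatrix-upperLeft : ∀ a b → blockMatrix (suc (suc m)) A B (a ↑ˡ (suc m ℕ.* k)) (b ↑ˡ (suc m ℕ.* k))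
                                      ≈ 𝟙 a b
      blockMatrix-upperLeft a b = trans (reflexive (blockMatrix-combine _ B zero zero a b)) (block-zero-zero a b)

      schurComplement-blockMatrix : schurComplement k (blockMatrix (suc (suc m)) A B)
                                    ≈ᴹ blockMatrix (suc m) A (mergeFirst B)
      schurComplement-blockMatrix = ≈ᴹ-byBlocks {suc m} (λ r c i j → begin
        schurComplement k (blockMatrix (suc (suc m)) A B) (combine r i) (combine c j)
          ≈⟨ +-cong (reflexive (blockMatrix-combine _ B (suc r) (suc c) i j))
                    (-‿cong (∑-cong (λ b → *-cong (reflexive (blockMatrix-combine _ B (suc r) zero i b))
                                                 (reflexive (blockMatrix-combine _ B zero (suc c) b j))))) ⟩
        blocks (suc r) (suc c) i j - ∑ (λ b → blocks (suc r) zero i b * blocks zero (suc c) b j)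
          ≈⟨ block-schur r c i j ⟩
        block (suc m) A (mergeFirst B) r c i j
          ≈⟨ reflexive (≡.sym (blockMatrix-combine _ (mergeFirst B) r c i j)) ⟩
        blockMatrix (suc m) A (mergeFirst B) (combine r i) (combine c j) ∎)

    det-blockMatrix-one : (B : Fin 1 → Matrix k k) → det (blockMatrix 1 A B) ≈ det (𝟙 ⊕ powerSum B)
    det-blockMatrix-one B = begin
      det M                                    ≈⟨ sym (det-cast k≡k+0 M) ⟩
      det (λ i j → M (cast k≡k+0 i) (cast k≡k+0 j)) ≈⟨ det-cong entries ⟩
      det (𝟙 ⊕ powerSum B)                     ∎
      where
      -- blockMatrix 1 A B has size 1 * k, which reduces to k + 0, not to k
      M = blockMatrix 1 A B
      k≡k+0 : k ≡ k ℕ.+ 0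
      k≡k+0 = ≡.sym (ℕₚ.+-identityʳ k)
      cast≡↑ˡ : ∀ i → cast k≡k+0 i ≡ i ↑ˡ 0
      cast≡↑ˡ i = Finₚ.toℕ-injective (≡.trans (Finₚ.toℕ-cast k≡k+0 i) (≡.sym (Finₚ.toℕ-↑ˡ i 0)))
      entries : (λ i j → M (cast k≡k+0 i) (cast k≡k+0 j)) ≈ᴹ 𝟙 ⊕ powerSum B
      entries i j = begin
        M (cast k≡k+0 i) (cast k≡k+0 j)
          ≈⟨ reflexive (≡.trans (≡.cong₂ M (cast≡↑ˡ i) (cast≡↑ˡ j))
                                (blockMatrix-combine 1 B zero zero i j)) ⟩
        block 1 A B zero zero i j
          ≈⟨ block-entry 1 B zero zero (δ-refl 0) (δ-0-suc 0) (δ-refl 1) i j ⟩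
        (1# * 𝟙 i j + 0# * A i j) + 1# * B zero i j
          ≈⟨ +-cong (trans (y≈0⇒x+y≈x (zeroˡ _)) (*-identityˡ _)) (*-identityˡ _) ⟩
        𝟙 i j + B zero i j
          ≈⟨ +-congˡ (sym (powerSum-one B i j)) ⟩
        (𝟙 ⊕ powerSum B) i j ∎

    det-blockMatrix : ∀ m (B : Fin (suc m) → Matrix k k) →
                      det (blockMatrix (suc m) A B) ≈ det (𝟙 ⊕ powerSum B)
    det-blockMatrix zero    B = det-blockMatrix-one B
    det-blockMatrix (suc m) B = begin
      det (blockMatrix (suc (suc m)) A B)
        ≈⟨ det-schur k _ (blockMatrix-upperLeft B) ⟩
      det (schurComplement k (blockMatrix (suc (suc m)) A B))
        ≈⟨ det-cong (schurComplement-blockMatrix B) ⟩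
      det (blockMatrix (suc m) A (mergeFirst B))
        ≈⟨ det-blockMatrix m (mergeFirst B) ⟩
      det (𝟙 ⊕ powerSum (mergeFirst B))
        ≈⟨ det-cong (⊕-cong ≈ᴹ-refl (powerSum-mergeFirst B)) ⟩
      det (𝟙 ⊕ powerSum B) ∎

lemma4p5 : ∀ {c ℓ} (R : CommutativeRing c ℓ) (n k : ℕ) → 1 ≤ n →
    (A : MatrixDefs.Matrix R k k) (B : Fin n → MatrixDefs.Matrix R k k) →
    CommutativeRing._≈_ R
      (MatrixDefs.det R (MatrixDefs.blockMatrix R n A B))
      (MatrixDefs.det R (MatrixDefs._⊕_ R (MatrixDefs.𝟙 R)
        (MatrixDefs.∑ᴹ R (λ (i : Fin n) →
          MatrixDefs._⊗_ R (MatrixDefs._^ᴹ_ R (MatrixDefs.⊖_ R A) (toℕ i)) (B (opposite i))))))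
lemma4p5 R zero    k () A B
lemma4p5 R (suc m) k _  A B = det-blockMatrix R A m B
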